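{- Let $M=(E,\mathcal{I})$ be a matroid with a coloring of $E$, let $t$ be a positive integer, and let $I_1,\dots,I_t$ be pairwise disjoint rainbow independent sets of $M$ such that $\sum_{i=1}^t|I_i|\geq t-1+|c(\bigcup_{i=1}^tI_i)|$ and each color appearing in $\bigcup_{i=1}^tI_i$ appears on at least two elements of $E$. Let $F$ be a flat of $M$ such that: if $r_M(F)\leq r_M(E)-2$ then $|c(E\setminus F)|\geq t\,(r_M(E)-r_M(F)-1)+\eta(F)+\xi(F)+1$, and if $r_M(F)=r_M(E)-1$ then $|c(E\setminus F)|\geq \eta(F)+\xi(F)+1$. Then $$\Big|c(E\setminus F)\setminus c\big(\textstyle\bigcup_{i=1}^tI_i\big)\Big|+\sum_{i=1}^t|I_i\cap(E\setminus F)|\geq t\,(r_M(E)-r_M(F)).$$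
   Context: All matroids have finite ground sets; $r_M(S)$ is the rank of $S\subseteq E$; a flat is a set $F$ with $cl(F)=F$, where $cl(S)=\{x\in E: r_M(S\cup\{x\})=r_M(S)\}$. For $S\subseteq E$, $c(S)$ is the set of colors appearing on elements of $S$; a set is rainbow if its elements have pairwise distinct colors. For a set $F\subseteq E$, $\eta(F):=|F|-|c(F)|$ and $\xi(F):=|c(F)\cap c(E\setminus F)|$. -}

module Defs where

import Data.Nat
open import Data.Nat using (ℕ; zero; suc; _<_; _⊔_)
open import Data.Fin using (Fin)
open import Data.Fin.Subset
open import Data.Fin.Subset.Properties using (_∈?_; _⊆?_)
open import Data.Fin.Properties using (any?)
open import Data.List using (List; []; _∷_; map; _++_; filter; foldr)
open import Data.Vec using (_∷_; []; tabulate)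
open import Data.Product using (_×_; ∃)
open import Relation.Nullary using (Dec; yes; no; does)
open import Relation.Nullary.Decidable using (_×-dec_)
open import Relation.Unary using (Decidable)
open import Relation.Binary.PropositionalEquality using (_≡_)
open import Data.Fin using (_≟_)

-- A matroid on the finite ground set E = Fin n, given by its independent sets.
-- (Independence is assumed decidable; harmless for finite ground sets and
--  needed to compute the rank function.)
record Matroid (n : ℕ) : Set₁ where
  field
    Indep     : Subset n → Set
    Indep?    : Decidable Indep
    indep-∅   : Indep ⊥
    indep-⊆   : ∀ {X Y} → X ⊆ Y → Indep Y → Indep X
    indep-aug : ∀ {X Y} → Indep X → Indep Y → ∣ X ∣ < ∣ Y ∣ →
                ∃ λ y → y ∈ Y × y ∉ X × Indep (X ∪ ⁅ y ⁆)

allSubsets : (n : ℕ) → List (Subset n)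
allSubsets zero = [] ∷ []
allSubsets (suc n) = map (inside ∷_) (allSubsets n) ++ map (outside ∷_) (allSubsets n)

maximum : List ℕ → ℕ
maximum = foldr _⊔_ 0

rank : ∀ {n} → Matroid n → Subset n → ℕ
rank {n} M S = maximum (map ∣_∣ (filter (λ X → (X ⊆? S) ×-dec Indep? X) (allSubsets n)))
  where open Matroid M

cl : ∀ {n} → Matroid n → Subset n → Subset n
cl M S = tabulate λ x → if-dec (Data.Nat._≟_ (rank M (S ∪ ⁅ x ⁆)) (rank M S))
  where
  if-dec : ∀ {P : Set} → Dec P → Side
  if-dec (yes _) = inside
  if-dec (no _)  = outside

IsFlat : ∀ {n} → Matroid n → Subset n → Set
IsFlat M F = cl M F ≡ F

colors : ∀ {n m} → (Fin n → Fin m) → Subset n → Subset m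
colors {n} c S = tabulate λ j → side (any? λ x → (x ∈? S) ×-dec (c x ≟ j))
  where
  side : ∀ {P : Set} → Dec P → Side
  side (yes _) = inside
  side (no _)  = outside

Rainbow : ∀ {n m} → (Fin n → Fin m) → Subset n → Set
Rainbow c S = ∀ x y → x ∈ S → y ∈ S → c x ≡ c y → x ≡ y

η : ∀ {n m} → (Fin n → Fin m) → Subset n → ℕ
η c F = ∣ F ∣ Data.Nat.∸ ∣ colors c F ∣

ξ : ∀ {n m} → (Fin n → Fin m) → Subset n → ℕ
ξ c F = ∣ colors c F ∩ colors c (∁ F) ∣

-- Put U = I₁ ∪ … ∪ Iₜ. The elements of the
-- Iᵢ lying in F number at most |U ∩ F| ≤ |c(U ∩ F)| + η(F), as η is monotone.
-- A colour of E ∖ F that occurs on U either avoids c(U ∩ F) or lies in c(F), where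
-- ξ(F) counts it. With Σ|Iᵢ| ≥ t − 1 + |c(U)| this gives
--   |c(E ∖ F)| + t − 1 ≤ |c(E ∖ F) ∖ c(U)| + Σ|Iᵢ ∖ F| + η(F) + ξ(F),
-- and the lower bound on |c(E ∖ F)| for the given rank gap closes the argument.

module Submission where

open import Defs
open import Data.Nat using (ℕ; zero; suc; _+_; _*_; _∸_; _≤_; _≥_; z≤n; s≤s)
open import Data.Nat.Properties
  using (n≤1+n; 1+n≢0; +-suc; +-assoc; +-commutativeSemigroup; ≤-reflexive; ≤-trans; <⇒≤; +-mono-≤; +-monoˡ-≤; +-monoʳ-≤; +-cancelˡ-≤; +-cancelʳ-≤;
         *-zeroʳ; ∸-mono; m≤n+m∸n; [m+n]∸[m+o]≡n∸o; m∸n≢0⇒n<m; m+[n∸m]≡n; module ≤-Reasoning)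
open import Data.Nat.Tactic.RingSolver using (solve-∀)
open import Algebra.Properties.CommutativeSemigroup +-commutativeSemigroup using (interchange; x∙yz≈zx∙y)
open import Data.Nat.ListAction using (sum)
open import Data.Fin using (Fin; zero; suc; _≟_)
open import Data.Fin.Properties using (any?; ¬Fin0)
open import Data.Fin.Subset
open import Data.Fin.Subset.Properties
  using (_∈?_; ∉⊥; ∣⊥∣≡0; ∣⁅x⁆∣≡1; x∈⁅x⁆; p⊆q⇒∣p∣≤∣q∣; x∈p∪q⁻; x∈p∪q⁺; x∈p∩q⁺;
         p∩q⊆p; p∩q⊆q; x∈p∧x∉q⇒x∈p─q; x∉p⇒x∈∁p; x∈∁p⇒x∉p; ∩-distribʳ-∪)
open import Data.Vec using (_∷_; []; lookup; here; there)
open import Data.Vec.Properties using (lookup∘tabulate; []=⇒lookup; lookup⇒[]=)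
open import Data.List using (map; allFin) renaming (_∷_ to _∷ₗ_; [] to []ₗ)
open import Data.List.Relation.Unary.All using (All) renaming (_∷_ to _∷ᵃ_; [] to []ᵃ)
open import Data.List.Relation.Unary.AllPairs as AllPairs using (AllPairs) renaming (_∷_ to _∷ᵖ_; [] to []ᵖ)
open import Data.List.Relation.Unary.Unique.Propositional.Properties using (allFin⁺)
open import Data.Product using (∃; _×_; _,_; proj₁)
open import Data.Sum using ([_,_]′; inj₁; inj₂)
open import Data.Empty using (⊥-elim)
open import Function using (_∘_; _on_; _∋_)
open import Relation.Nullary using (¬_; yes; no; contradiction)
open import Relation.Nullary.Decidable using (_×-dec_)
open import Relation.Binary.PropositionalEquality using (_≡_; refl; sym; trans; cong; subst)

private
  variable
    n m : ℕ

Disjoint : Subset n → Subset n → Set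
Disjoint p q = ∀ {x} → x ∈ p → x ∉ q

∣p∪q∣≤∣p∣+∣q∣ : ∀ (p q : Subset n) → ∣ p ∪ q ∣ ≤ ∣ p ∣ + ∣ q ∣
∣p∪q∣≤∣p∣+∣q∣ []            []            = z≤n
∣p∪q∣≤∣p∣+∣q∣ (inside ∷ p)  (inside ∷ q)  = s≤s (≤-trans (∣p∪q∣≤∣p∣+∣q∣ p q) (+-monoʳ-≤ ∣ p ∣ (n≤1+n _)))
∣p∪q∣≤∣p∣+∣q∣ (inside ∷ p)  (outside ∷ q) = s≤s (∣p∪q∣≤∣p∣+∣q∣ p q)
∣p∪q∣≤∣p∣+∣q∣ (outside ∷ p) (inside ∷ q)  = ≤-trans (s≤s (∣p∪q∣≤∣p∣+∣q∣ p q)) (≤-reflexive (sym (+-suc _ _)))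
∣p∪q∣≤∣p∣+∣q∣ (outside ∷ p) (outside ∷ q) = ∣p∪q∣≤∣p∣+∣q∣ p q

Disjoint-∷⁻ : ∀ {s t} {p q : Subset n} → Disjoint (s ∷ p) (t ∷ q) → Disjoint p q
Disjoint-∷⁻ d x∈p x∈q = d (there x∈p) (there x∈q)

∣p∣+∣q∣≤∣p∪q∣ : ∀ (p q : Subset n) → Disjoint p q → ∣ p ∣ + ∣ q ∣ ≤ ∣ p ∪ q ∣
∣p∣+∣q∣≤∣p∪q∣ []            []            _ = z≤n
∣p∣+∣q∣≤∣p∪q∣ (inside ∷ p)  (inside ∷ q)  d = contradiction here (d here)
∣p∣+∣q∣≤∣p∪q∣ (inside ∷ p)  (outside ∷ q) d = s≤s (∣p∣+∣q∣≤∣p∪q∣ p q (Disjoint-∷⁻ d))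
∣p∣+∣q∣≤∣p∪q∣ (outside ∷ p) (inside ∷ q)  d =
  ≤-trans (≤-reflexive (+-suc ∣ p ∣ ∣ q ∣)) (s≤s (∣p∣+∣q∣≤∣p∪q∣ p q (Disjoint-∷⁻ d)))
∣p∣+∣q∣≤∣p∪q∣ (outside ∷ p) (outside ∷ q) d = ∣p∣+∣q∣≤∣p∪q∣ p q (Disjoint-∷⁻ d)

p⊆q∪r⇒∣p∣≤∣q∣+∣r∣ : ∀ {p} (q r : Subset n) → p ⊆ q ∪ r → ∣ p ∣ ≤ ∣ q ∣ + ∣ r ∣
p⊆q∪r⇒∣p∣≤∣q∣+∣r∣ q r p⊆q∪r = ≤-trans (p⊆q⇒∣p∣≤∣q∣ p⊆q∪r) (∣p∪q∣≤∣p∣+∣q∣ q r)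

p,q⊆r⇒∣p∣+∣q∣≤∣r∣ : ∀ p q {r : Subset n} → Disjoint p q → p ⊆ r → q ⊆ r → ∣ p ∣ + ∣ q ∣ ≤ ∣ r ∣
p,q⊆r⇒∣p∣+∣q∣≤∣r∣ p q d p⊆r q⊆r =
  ≤-trans (∣p∣+∣q∣≤∣p∪q∣ p q d) (p⊆q⇒∣p∣≤∣q∣ ([ p⊆r , q⊆r ]′ ∘ x∈p∪q⁻ p q))

p⊆p∩q∪p∩∁q : ∀ (p q : Subset n) → p ⊆ p ∩ q ∪ p ∩ ∁ q
p⊆p∩q∪p∩∁q p q {x} x∈p with x ∈? q
... | yes x∈q = x∈p∪q⁺ (inj₁ (x∈p∩q⁺ (x∈p , x∈q)))
... | no  x∉q = x∈p∪q⁺ (inj₂ (x∈p∩q⁺ (x∈p , x∉p⇒x∈∁p x∉q)))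

module _ (c : Fin n → Fin m) where

  ∈-colors⁻ : ∀ p {k} → k ∈ colors c p → ∃ λ x → x ∈ p × c x ≡ k
  ∈-colors⁻ p {k} k∈
    with any? (λ x → (x ∈? p) ×-dec (c x ≟ k)) | trans (sym (lookup∘tabulate _ k)) ([]=⇒lookup k∈)
  ... | yes witness | _ = witness
  ... | no _        | ()

  ∈-colors⁺ : ∀ {p x} → x ∈ p → c x ∈ colors c p
  ∈-colors⁺ {p} {x} x∈p
    with any? (λ y → (y ∈? p) ×-dec (c y ≟ c x)) | (lookup (colors c p) (c x) ≡ _ ∋ lookup∘tabulate _ (c x))
  ... | yes _ | eq = lookup⇒[]= (c x) _ eq
  ... | no ¬∃ | _  = contradiction (x , x∈p , refl) ¬∃

  colors-mono : ∀ {p q} → p ⊆ q → colors c p ⊆ colors c q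
  colors-mono {p} p⊆q k∈ with ∈-colors⁻ p k∈
  ... | x , x∈p , refl = ∈-colors⁺ (p⊆q x∈p)

  colors-∪ : ∀ p q → colors c (p ∪ q) ⊆ colors c p ∪ colors c q
  colors-∪ p q k∈ with ∈-colors⁻ (p ∪ q) k∈
  ... | x , x∈p∪q , refl = x∈p∪q⁺ ([ inj₁ ∘ ∈-colors⁺ , inj₂ ∘ ∈-colors⁺ ]′ (x∈p∪q⁻ p q x∈p∪q))

∣colors∣≤∣p∣ : ∀ (c : Fin n → Fin m) p → ∣ colors c p ∣ ≤ ∣ p ∣
∣colors∣≤∣p∣ {zero} {m} c [] =
  ≤-trans (p⊆q⇒∣p∣≤∣q∣ {q = ⊥} (λ k∈ → ⊥-elim (¬Fin0 (proj₁ (∈-colors⁻ c [] k∈))))) (≤-reflexive (∣⊥∣≡0 m))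
∣colors∣≤∣p∣ {suc n} c (inside ∷ p) =
  ≤-trans (p⊆q∪r⇒∣p∣≤∣q∣+∣r∣ ⁅ c zero ⁆ (colors (c ∘ suc) p) split)
          (≤-trans (≤-reflexive (cong (_+ ∣ colors (c ∘ suc) p ∣) (∣⁅x⁆∣≡1 (c zero)))) (s≤s (∣colors∣≤∣p∣ (c ∘ suc) p)))
  where
  split : colors c (inside ∷ p) ⊆ ⁅ c zero ⁆ ∪ colors (c ∘ suc) p
  split k∈ with ∈-colors⁻ c (inside ∷ p) k∈
  ... | zero  , _         , refl = x∈p∪q⁺ (inj₁ (x∈⁅x⁆ (c zero)))
  ... | suc x , there x∈p , refl = x∈p∪q⁺ (inj₂ (∈-colors⁺ (c ∘ suc) x∈p))
∣colors∣≤∣p∣ {suc n} c (outside ∷ p) = ≤-trans (p⊆q⇒∣p∣≤∣q∣ shift) (∣colors∣≤∣p∣ (c ∘ suc) p)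
  where
  shift : colors c (outside ∷ p) ⊆ colors (c ∘ suc) p
  shift k∈ with ∈-colors⁻ c (outside ∷ p) k∈
  ... | suc x , there x∈p , refl = ∈-colors⁺ (c ∘ suc) x∈p

η-mono : ∀ (c : Fin n → Fin m) {p q} → p ⊆ q → η c p ≤ η c q
η-mono c {p} {q} p⊆q = begin
  ∣ p ∣ ∸ ∣ colors c p ∣                         ≡⟨ [m+n]∸[m+o]≡n∸o (∣ d ∣) (∣ p ∣) (∣ colors c p ∣) ⟨
  (∣ d ∣ + ∣ p ∣) ∸ (∣ d ∣ + ∣ colors c p ∣)     ≤⟨ ∸-mono sizes colours ⟩
  ∣ q ∣ ∸ ∣ colors c q ∣                         ∎
  where
  open ≤-Reasoning
  d = q ∩ ∁ p
  q⊆d∪p : q ⊆ d ∪ p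
  q⊆d∪p {x} x∈q with x ∈? p
  ... | yes x∈p = x∈p∪q⁺ (inj₂ x∈p)
  ... | no  x∉p = x∈p∪q⁺ (inj₁ (x∈p∩q⁺ (x∈q , x∉p⇒x∈∁p x∉p)))
  sizes : ∣ d ∣ + ∣ p ∣ ≤ ∣ q ∣
  sizes = p,q⊆r⇒∣p∣+∣q∣≤∣r∣ d p (x∈∁p⇒x∉p ∘ p∩q⊆q q (∁ p)) (p∩q⊆p q (∁ p)) p⊆q
  colours : ∣ colors c q ∣ ≤ ∣ d ∣ + ∣ colors c p ∣
  colours = ≤-trans (p⊆q∪r⇒∣p∣≤∣q∣+∣r∣ (colors c d) (colors c p) (colors-∪ c d p ∘ colors-mono c q⊆d∪p))
                    (+-monoˡ-≤ _ (∣colors∣≤∣p∣ c d))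

module _ {ι : Set} (I : ι → Subset n) where

  Disjoint-⋃ : ∀ {p} L → All (Disjoint p ∘ I) L → Disjoint p (⋃ (map I L))
  Disjoint-⋃ []ₗ       []ᵃ       _   x∈⊥ = ∉⊥ x∈⊥
  Disjoint-⋃ (i ∷ₗ L) (d ∷ᵃ ds) x∈p x∈∪ = [ d x∈p , Disjoint-⋃ L ds x∈p ]′ (x∈p∪q⁻ (I i) _ x∈∪)

  ∑∣Iᵢ∩q∣≤∣⋃I∩q∣ : ∀ q L → AllPairs (Disjoint on I) L →
                   sum (map (λ i → ∣ I i ∩ q ∣) L) ≤ ∣ ⋃ (map I L) ∩ q ∣
  ∑∣Iᵢ∩q∣≤∣⋃I∩q∣ q []ₗ       []ᵖ         = z≤n
  ∑∣Iᵢ∩q∣≤∣⋃I∩q∣ q (i ∷ₗ L) (ds ∷ᵖ dss) = begin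
    ∣ I i ∩ q ∣ + sum (map (λ j → ∣ I j ∩ q ∣) L) ≤⟨ +-monoʳ-≤ ∣ I i ∩ q ∣ (∑∣Iᵢ∩q∣≤∣⋃I∩q∣ q L dss) ⟩
    ∣ I i ∩ q ∣ + ∣ U ∩ q ∣                      ≤⟨ ∣p∣+∣q∣≤∣p∪q∣ (I i ∩ q) (U ∩ q) disjoint ⟩
    ∣ I i ∩ q ∪ U ∩ q ∣                          ≡⟨ cong ∣_∣ (∩-distribʳ-∪ q (I i) U) ⟨
    ∣ (I i ∪ U) ∩ q ∣                            ∎
    where
    open ≤-Reasoning
    U = ⋃ (map I L)
    disjoint : Disjoint (I i ∩ q) (U ∩ q)
    disjoint x∈ x∈′ = Disjoint-⋃ L ds (p∩q⊆p _ _ x∈) (p∩q⊆p _ _ x∈′)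

  ∑∣Iᵢ∣≤∑∣Iᵢ∩q∣+∑∣Iᵢ∩∁q∣ : ∀ q L → sum (map (λ i → ∣ I i ∣) L) ≤
                           sum (map (λ i → ∣ I i ∩ q ∣) L) + sum (map (λ i → ∣ I i ∩ ∁ q ∣) L)
  ∑∣Iᵢ∣≤∑∣Iᵢ∩q∣+∑∣Iᵢ∩∁q∣ q []ₗ       = z≤n
  ∑∣Iᵢ∣≤∑∣Iᵢ∩q∣+∑∣Iᵢ∩∁q∣ q (i ∷ₗ L) = begin
    ∣ I i ∣ + sum (map (λ j → ∣ I j ∣) L)
      ≤⟨ +-mono-≤ (p⊆q∪r⇒∣p∣≤∣q∣+∣r∣ (I i ∩ q) (I i ∩ ∁ q) (p⊆p∩q∪p∩∁q (I i) q))
                  (∑∣Iᵢ∣≤∑∣Iᵢ∩q∣+∑∣Iᵢ∩∁q∣ q L) ⟩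
    (∣ I i ∩ q ∣ + ∣ I i ∩ ∁ q ∣) + (sum (map (λ j → ∣ I j ∩ q ∣) L) + sum (map (λ j → ∣ I j ∩ ∁ q ∣) L))
      ≡⟨ interchange ∣ I i ∩ q ∣ ∣ I i ∩ ∁ q ∣ _ _ ⟩
    (∣ I i ∩ q ∣ + sum (map (λ j → ∣ I j ∩ q ∣) L)) + (∣ I i ∩ ∁ q ∣ + sum (map (λ j → ∣ I j ∩ ∁ q ∣) L))
      ∎
    where open ≤-Reasoning

colour-count : ∀ {ι : Set} (c : Fin n → Fin m) (I : ι → Subset n) F L → AllPairs (Disjoint on I) L →
  sum (map (λ i → ∣ I i ∣) L) + ∣ colors c (∁ F) ∣ ≤
  ∣ colors c (⋃ (map I L)) ∣
    + ((∣ colors c (∁ F) ─ colors c (⋃ (map I L)) ∣ + sum (map (λ i → ∣ I i ∩ ∁ F ∣) L)) + (η c F + ξ c F))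
colour-count c I F L disjoint = begin
  sum (map (λ i → ∣ I i ∣) L) + ∣ A ∣  ≤⟨ +-monoˡ-≤ _ elements ⟩
  (∣ K ∣ + η c F + beyondF) + ∣ A ∣    ≡⟨ regroup₁ (∣ K ∣) (η c F) beyondF (∣ A ∣) ⟩
  (∣ K ∣ + ∣ A ∣) + (beyondF + η c F)  ≤⟨ +-monoˡ-≤ (beyondF + η c F) colours ⟩
  (∣ C ∣ + (ξ c F + ∣ A ─ C ∣)) + (beyondF + η c F)
                                       ≡⟨ regroup₂ (∣ C ∣) (ξ c F) (∣ A ─ C ∣) beyondF (η c F) ⟩
  ∣ C ∣ + ((∣ A ─ C ∣ + beyondF) + (η c F + ξ c F)) ∎
  where
  open ≤-Reasoning
  U = ⋃ (map I L)
  C = colors c U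
  A = colors c (∁ F)
  K = colors c (U ∩ F)
  beyondF = sum (map (λ i → ∣ I i ∩ ∁ F ∣) L)

  regroup₁ : ∀ k e o a → (k + e + o) + a ≡ (k + a) + (o + e)
  regroup₁ = solve-∀
  regroup₂ : ∀ z x d o e → (z + (x + d)) + (o + e) ≡ z + ((d + o) + (e + x))
  regroup₂ = solve-∀

  elements : sum (map (λ i → ∣ I i ∣) L) ≤ ∣ K ∣ + η c F + beyondF
  elements = begin
    sum (map (λ i → ∣ I i ∣) L)                     ≤⟨ ∑∣Iᵢ∣≤∑∣Iᵢ∩q∣+∑∣Iᵢ∩∁q∣ I F L ⟩
    sum (map (λ i → ∣ I i ∩ F ∣) L) + beyondF       ≤⟨ +-monoˡ-≤ beyondF (∑∣Iᵢ∩q∣≤∣⋃I∩q∣ I F L disjoint) ⟩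
    ∣ U ∩ F ∣ + beyondF                             ≤⟨ +-monoˡ-≤ beyondF (m≤n+m∸n ∣ U ∩ F ∣ ∣ K ∣) ⟩
    ∣ K ∣ + η c (U ∩ F) + beyondF                   ≤⟨ +-monoˡ-≤ beyondF (+-monoʳ-≤ ∣ K ∣ (η-mono c (p∩q⊆q U F))) ⟩
    ∣ K ∣ + η c F + beyondF                         ∎

  cover : A ⊆ C ∩ ∁ K ∪ (colors c F ∩ A ∪ (A ─ C))
  cover {k} k∈A with k ∈? C | k ∈? K
  ... | no  k∉C | _       = x∈p∪q⁺ (inj₂ (x∈p∪q⁺ (inj₂ (x∈p∧x∉q⇒x∈p─q k∈A k∉C))))
  ... | yes k∈C | no  k∉K = x∈p∪q⁺ (inj₁ (x∈p∩q⁺ (k∈C , x∉p⇒x∈∁p k∉K)))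
  ... | yes _   | yes k∈K = x∈p∪q⁺ (inj₂ (x∈p∪q⁺ (inj₁ (x∈p∩q⁺ (colors-mono c (p∩q⊆q U F) k∈K , k∈A)))))

  colours : ∣ K ∣ + ∣ A ∣ ≤ ∣ C ∣ + (ξ c F + ∣ A ─ C ∣)
  colours = begin
    ∣ K ∣ + ∣ A ∣
      ≤⟨ +-monoʳ-≤ ∣ K ∣ (≤-trans (p⊆q∪r⇒∣p∣≤∣q∣+∣r∣ (C ∩ ∁ K) _ cover)
                                  (+-monoʳ-≤ ∣ C ∩ ∁ K ∣ (∣p∪q∣≤∣p∣+∣q∣ (colors c F ∩ A) (A ─ C)))) ⟩
    ∣ K ∣ + (∣ C ∩ ∁ K ∣ + (ξ c F + ∣ A ─ C ∣))  ≡⟨ +-assoc ∣ K ∣ ∣ C ∩ ∁ K ∣ _ ⟨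
    (∣ K ∣ + ∣ C ∩ ∁ K ∣) + (ξ c F + ∣ A ─ C ∣)
      ≤⟨ +-monoˡ-≤ _ (p,q⊆r⇒∣p∣+∣q∣≤∣r∣ K (C ∩ ∁ K) (λ k∈K k∈ → x∈∁p⇒x∉p (p∩q⊆q C (∁ K) k∈) k∈K)
                                         (colors-mono c (p∩q⊆p U F)) (p∩q⊆p C (∁ K))) ⟩
    ∣ C ∣ + (ξ c F + ∣ A ─ C ∣)                  ∎

m∸n≡1+o⇒n+1+o≡m : ∀ {m n o} → m ∸ n ≡ suc o → n + suc o ≡ m
m∸n≡1+o⇒n+1+o≡m {m} {n} eq =
  trans (cong (n +_) (sym eq)) (m+[n∸m]≡n (<⇒≤ (m∸n≢0⇒n<m {m} {n} (1+n≢0 ∘ trans (sym eq)))))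

t*[1+k]≤ : ∀ {t k e₁ e₂ a L} → 1 ≤ t → t * k + e₁ + e₂ + 1 ≤ a → a + (t ∸ 1) ≤ L + (e₁ + e₂) →
           t * suc k ≤ L
t*[1+k]≤ {suc t} {k} {e₁} {e₂} {a} {L} _ a-large a-small = +-cancelʳ-≤ (e₁ + e₂) _ _ (begin
  suc t * suc k + (e₁ + e₂)    ≡⟨ regroup t k e₁ e₂ ⟩
  suc t * k + e₁ + e₂ + 1 + t  ≤⟨ +-monoˡ-≤ t a-large ⟩
  a + t                        ≤⟨ a-small ⟩
  L + (e₁ + e₂)                ∎)
  where
  open ≤-Reasoning
  regroup : ∀ t k e₁ e₂ → suc t * suc k + (e₁ + e₂) ≡ suc t * k + e₁ + e₂ + 1 + t
  regroup = solve-∀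

t*[R∸r]≤ : ∀ {t r R e₁ e₂ a L} → 1 ≤ t → a + (t ∸ 1) ≤ L + (e₁ + e₂) →
           (r + 2 ≤ R → t * (R ∸ r ∸ 1) + e₁ + e₂ + 1 ≤ a) → (r + 1 ≡ R → e₁ + e₂ + 1 ≤ a) →
           t * (R ∸ r) ≤ L
t*[R∸r]≤ {t} {r} {R} {e₁} {e₂} {a} t≥1 a-small far near with R ∸ r in gap
... | zero        = ≤-trans (≤-reflexive (*-zeroʳ t)) z≤n
... | suc zero    =
  t*[1+k]≤ t≥1 (subst (λ x → x + e₁ + e₂ + 1 ≤ a) (sym (*-zeroʳ t)) (near (m∸n≡1+o⇒n+1+o≡m gap))) a-small
... | suc (suc k) =
  t*[1+k]≤ t≥1 (far (≤-trans (+-monoʳ-≤ r (s≤s (s≤s z≤n))) (≤-reflexive (m∸n≡1+o⇒n+1+o≡m gap)))) a-small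

lemma12 : ∀ {n m} (M : Matroid n) (c : Fin n → Fin m) (t : ℕ) (I : Fin t → Subset n) (F : Subset n) →
    1 ≤ t →
    (∀ i → Matroid.Indep M (I i)) →
    (∀ i → Rainbow c (I i)) →
    (∀ i j x → x ∈ I i → x ∈ I j → i ≡ j) →
    sum (map (λ i → ∣ I i ∣) (allFin t)) ≥ t ∸ 1 + ∣ colors c (⋃ (map I (allFin t))) ∣ →
    (∀ k → k ∈ colors c (⋃ (map I (allFin t))) →
      ∃ λ x → ∃ λ y → ¬ x ≡ y × c x ≡ k × c y ≡ k) →
    IsFlat M F →
    (rank M F + 2 ≤ rank M ⊤ →
      ∣ colors c (∁ F) ∣ ≥ t * (rank M ⊤ ∸ rank M F ∸ 1) + η c F + ξ c F + 1) →
    (rank M F + 1 ≡ rank M ⊤ →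
      ∣ colors c (∁ F) ∣ ≥ η c F + ξ c F + 1) →
    ∣ colors c (∁ F) ─ colors c (⋃ (map I (allFin t))) ∣
      + sum (map (λ i → ∣ I i ∩ ∁ F ∣) (allFin t))
      ≥ t * (rank M ⊤ ∸ rank M F)
lemma12 M c t I F t≥1 _ _ disjoint many-elements _ _ far near = t*[R∸r]≤ t≥1 few-colours far near
  where
  open ≤-Reasoning
  U = ⋃ (map I (allFin t))
  A = colors c (∁ F)
  beyondF = sum (map (λ i → ∣ I i ∩ ∁ F ∣) (allFin t))

  pairwise-disjoint : AllPairs (Disjoint on I) (allFin t)
  pairwise-disjoint = AllPairs.map (λ i≢j {x} x∈Iᵢ x∈Iⱼ → i≢j (disjoint _ _ x x∈Iᵢ x∈Iⱼ)) (allFin⁺ t)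

  few-colours : ∣ A ∣ + (t ∸ 1) ≤ (∣ A ─ colors c U ∣ + beyondF) + (η c F + ξ c F)
  few-colours = +-cancelˡ-≤ ∣ colors c U ∣ _ _ (begin
    ∣ colors c U ∣ + (∣ A ∣ + (t ∸ 1))            ≡⟨ x∙yz≈zx∙y (∣ colors c U ∣) (∣ A ∣) (t ∸ 1) ⟩
    (t ∸ 1 + ∣ colors c U ∣) + ∣ A ∣              ≤⟨ +-monoˡ-≤ _ many-elements ⟩
    sum (map (λ i → ∣ I i ∣) (allFin t)) + ∣ A ∣  ≤⟨ colour-count c I F (allFin t) pairwise-disjoint ⟩
    ∣ colors c U ∣ + ((∣ A ─ colors c U ∣ + beyondF) + (η c F + ξ c F)) ∎)
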